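{- Let $A=\{a_{ij}: i,j\ge 1\}$ be noncommuting variables with the relation $a_{ij}\prec a_{kl}$ iff $j=k$. For a permutation $\sigma\in\mathfrak S_n$ set $$\mathbf S^\sigma(A)=\sum_{i_1,\dots,i_n\ge1} a_{i_{\sigma^{ -1}(1)}i_1}\,a_{i_{\sigma^{ -1}(2)}i_2}\cdots a_{i_{\sigma^{ -1}(n)}i_n}.$$ Then $\mathbf S^\sigma(A)\mathbf S^\tau(A)=\mathbf S^{\sigma\bullet\tau}(A)$ for all permutations $\sigma,\tau$, and the $\mathbf S^\sigma(A)$ span a Hopf algebra isomorphic to $\mathbf{SGSym}$ (via $\mathbf S^\sigma(A)\mapsto\mathbf S^\sigma$) for the coproduct $\Delta F(A)=F(A\oplus B)$.
   Context: $\sigma\bullet\tau$ (shifted concatenation) for $\sigma\in\mathfrak S_m,\tau\in\mathfrak S_n$ is the permutation of $[m+n]$ equal to $\sigma$ on $[m]$ and sending $m+i$ to $m+\tau(i)$. $\mathbf S^\sigma(A)$ equals the sum of all words $w_1\cdots w_n$ over $A$ with $w_i\prec w_{\sigma(i)}$ for all $i$. $B=\{b_{ij}\}$ is a copy of $A$ whose letters commute with those of $A$ (product $P(A)Q(B)$ identified with $P\otimes Q$); $A\oplus B$ is $A\sqcup B$ with relation: $a_{ij}\prec a_{kl}$ and $b_{ij}\prec b_{kl}$ iff $j=k$, $a\prec b$ for all $a\in A,b\in B$, never $b\prec a$; $\mathbf S^\sigma(A\oplus B)$ is the sum of all words over $A\sqcup B$ with $w_i\prec w_{\sigma(i)}$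 for all $i$. For $I\subseteq[n]$ a union of cycles of $\sigma$, $\mathrm{std}(\sigma|_I)$ is the permutation of $[|I|]$ obtained by transporting $\sigma|_I$ via the increasing bijection $I\to[|I|]$. $\mathbf{SGSym}$ is the Hopf algebra with basis $\{\mathbf S^\sigma\}$ indexed by all permutations (of all $n\ge0$), product $\mathbf S^\sigma\mathbf S^\tau=\mathbf S^{\sigma\bullet\tau}$, and coproduct $\Delta\mathbf S^\sigma=\sum_I \mathbf S^{\mathrm{std}(\sigma|_{[n]\setminus I})}\otimes\mathbf S^{\mathrm{std}(\sigma|_I)}$, over all subsets $I$ of $[n]$ that are unions of cycles of $\sigma$. -}

module Defs where

open import Data.Nat using (ℕ; zero; suc)
import Data.Nat as ℕ
open import Data.Integer using (ℤ; 0ℤ; 1ℤ) renaming (_+_ to _+ℤ_; _*_ to _*ℤ_)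
open import Data.Bool using (Bool; true; false; if_then_else_)
open import Data.Fin using (Fin; toℕ; cast)
open import Data.Fin.Properties using (+↔⊎; all?; any?)
open import Data.Fin.Permutation using (Permutation′; _⟨$⟩ʳ_; _∘ₚ_; flip)
open import Data.Fin.Subset using (Subset; ∁)
open import Data.Sum using (_⊎_; inj₁; inj₂)
open import Data.Sum.Function.Propositional using (_⊎-↔_)
open import Function.Construct.Composition using (_↔-∘_)
open import Function.Construct.Symmetry using (↔-sym)
open import Data.Product using (Σ; _×_; _,_; proj₁; proj₂)
open import Data.List using (List; []; _∷_; _++_; map; length; allFin; concatMap; foldr)
import Data.List as L
open import Data.Vec using (Vec; []; _∷_)
open import Data.Unit using (⊤)
open import Data.Empty using (⊥)
open import Relation.Nullary using (Dec; yes; no; does)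
open import Relation.Binary.PropositionalEquality using (_≡_; sym)

Letter : Set
Letter = ℕ × ℕ

_≺_ : Letter → Letter → Set
(i , j) ≺ (k , l) = j ≡ k

_≺?_ : (x y : Letter) → Dec (x ≺ y)
(i , j) ≺? (k , l) = j ℕ.≟ k

-- Letters of A ⊔ B : inj₁ = letter of A, inj₂ = letter of B (a copy).
LetterAB : Set
LetterAB = Letter ⊎ Letter

_≺⊕_ : LetterAB → LetterAB → Set
inj₁ x ≺⊕ inj₁ y = x ≺ y
inj₂ x ≺⊕ inj₂ y = x ≺ y
inj₁ x ≺⊕ inj₂ y = ⊤
inj₂ x ≺⊕ inj₁ y = ⊥

_≺⊕?_ : (x y : LetterAB) → Dec (x ≺⊕ y)
inj₁ x ≺⊕? inj₁ y = x ≺? y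
inj₂ x ≺⊕? inj₂ y = x ≺? y
inj₁ x ≺⊕? inj₂ y = yes _
inj₂ x ≺⊕? inj₁ y = no (λ ())

-- Noncommutative formal power series over an alphabet X with integer
-- coefficients: a series is its coefficient function on words.

Series : Set → Set
Series X = List X → ℤ

sumℤ : List ℤ → ℤ
sumℤ = foldr _+ℤ_ 0ℤ

splits : {X : Set} → List X → List (List X × List X)
splits []       = ([] , []) ∷ []
splits (x ∷ xs) = ([] , x ∷ xs) ∷ map (λ p → (x ∷ proj₁ p , proj₂ p)) (splits xs)

_⊛_ : {X : Set} → Series X → Series X → Series X
(F ⊛ G) w = sumℤ (map (λ p → F (proj₁ p) *ℤ G (proj₂ p)) (splits w))

oneS : {X : Set} → Series X
oneS []      = 1ℤ
oneS (_ ∷ _) = 0ℤ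

-- S^f over an alphabet with a decidable relation, for f : [n] → [n]:
-- the sum of all words w₁⋯wₙ with w_i ≺ w_{f(i)} for all i.
-- (Coefficient of a word: 1 if it satisfies this, 0 otherwise.)

SGen : {X : Set} (R : X → X → Set) → ((x y : X) → Dec (R x y)) →
       {n : ℕ} → (Fin n → Fin n) → Series X
SGen R R? {n} f w with length w ℕ.≟ n
... | no _  = 0ℤ
... | yes e =
  if does (all? (λ i → R? (L.lookup w (cast (sym e) i))
                          (L.lookup w (cast (sym e) (f i)))))
  then 1ℤ else 0ℤ

SA : {n : ℕ} → (Fin n → Fin n) → Series Letter
SA = SGen _≺_ _≺?_

SAB : {n : ℕ} → (Fin n → Fin n) → Series LetterAB
SAB = SGen _≺⊕_ _≺⊕?_

𝐒 : {n : ℕ} → Permutation′ n → Series Letter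
𝐒 σ = SA (σ ⟨$⟩ʳ_)

-- Shifted concatenation σ • τ : equal to σ on [m], m+i ↦ m+τ(i).

_•_ : {m n : ℕ} → Permutation′ m → Permutation′ n → Permutation′ (m ℕ.+ n)
σ • τ = ↔-sym +↔⊎ ↔-∘ ((σ ⊎-↔ τ) ↔-∘ +↔⊎)

ε₀ : Permutation′ 0
ε₀ = Data.Fin.Permutation.id

-- Series in commuting alphabets A and B, i.e. elements of P(A)Q(B),
-- identified with the tensor product: coefficient of u(A) v(B).

Series₂ : Set
Series₂ = List Letter → List Letter → ℤ

shuffles : List Letter → List Letter → List (List LetterAB)
shuffles []       []       = [] ∷ []
shuffles []       (y ∷ ys) = map (inj₂ y ∷_) (shuffles [] ys)
shuffles (x ∷ xs) []       = map (inj₁ x ∷_) (shuffles xs [])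
shuffles (x ∷ xs) (y ∷ ys) = map (inj₁ x ∷_) (shuffles xs (y ∷ ys))
                           ++ map (inj₂ y ∷_) (shuffles (x ∷ xs) ys)

-- Image of a series over A ⊔ B once the letters of A commute with
-- those of B: the coefficient of u(A)v(B) collects all words over
-- A ⊔ B with A-subword u and B-subword v.
commuteAB : Series LetterAB → Series₂
commuteAB F u v = sumℤ (map F (shuffles u v))

Δ𝐒 : {n : ℕ} → Permutation′ n → Series₂
Δ𝐒 σ = commuteAB (SAB (σ ⟨$⟩ʳ_))

_⊗_ : Series Letter → Series Letter → Series₂
(F ⊗ G) u v = F u *ℤ G v

sum₂ : List Series₂ → Series₂
sum₂ Fs u v = sumℤ (map (λ F → F u v) Fs)

allSubsets : (n : ℕ) → List (Subset n)
allSubsets zero    = [] ∷ []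
allSubsets (suc n) = map (false ∷_) (allSubsets n) ++ map (true ∷_) (allSubsets n)

elems : {n : ℕ} → Subset n → List (Fin n)
elems []           = []
elems (false ∷ p)  = map Fin.suc (elems p)
  where import Data.Fin as Fin
elems (true ∷ p)   = Fin.zero ∷ map Fin.suc (elems p)
  where import Data.Fin as Fin

_∈ₛ_ : {n : ℕ} → Fin n → Subset n → Set
i ∈ₛ I = Data.Vec.lookup I i ≡ true

_∈ₛ?_ : {n : ℕ} (i : Fin n) (I : Subset n) → Dec (i ∈ₛ I)
i ∈ₛ? I = Data.Bool._≟_ (Data.Vec.lookup I i) true

IsUnionOfCycles : {n : ℕ} → Permutation′ n → Subset n → Set
IsUnionOfCycles σ I =
  ((i : Fin _) → i ∈ₛ I → (σ ⟨$⟩ʳ i) ∈ₛ I) ×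
  ((i : Fin _) → i ∈ₛ I → (σ Data.Fin.Permutation.⟨$⟩ˡ i) ∈ₛ I)

isUnionOfCycles? : {n : ℕ} (σ : Permutation′ n) (I : Subset n) →
                   Dec (IsUnionOfCycles σ I)
isUnionOfCycles? σ I =
  Relation.Nullary.Decidable._×-dec_
    (all? (λ i → Relation.Nullary.Decidable._→-dec_ (i ∈ₛ? I) ((σ ⟨$⟩ʳ i) ∈ₛ? I)))
    (all? (λ i → Relation.Nullary.Decidable._→-dec_ (i ∈ₛ? I)
                   ((σ Data.Fin.Permutation.⟨$⟩ˡ i) ∈ₛ? I)))
  where import Relation.Nullary.Decidable

cycleUnions : {n : ℕ} → Permutation′ n → List (Subset n)
cycleUnions {n} σ = L.filter (isUnionOfCycles? σ) (allSubsets n)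

-- std(σ|_I) : transport σ|_I along the increasing bijection
-- e : [|I|] → I (e x = x-th element of I).  For x : Fin |I| it returns
-- the unique y with e y = σ (e x); when I is a union of cycles such y
-- always exists (the fallback branch is then never used).
std : {n : ℕ} → Permutation′ n → (I : Subset n) →
      Fin (length (elems I)) → Fin (length (elems I))
std σ I x with any? (λ y → Data.Fin._≟_ (L.lookup (elems I) y)
                                        (σ ⟨$⟩ʳ L.lookup (elems I) x))
... | yes (y , _) = y
... | no _        = x

Perm : Set
Perm = Σ ℕ Permutation′

-- the permutation as the word σ(1)⋯σ(n) (determines n and σ)
code : Perm → List ℕ
code (n , σ) = map (λ i → toℕ (σ ⟨$⟩ʳ i)) (allFin n)

evalComb : List (Perm × ℤ) → Series Letter
evalComb L w = sumℤ (map (λ t → proj₂ t *ℤ 𝐒 (proj₂ (proj₁ t)) w) L)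

module Submission where

-- Every 𝐒^f is the indicator series of its admissible words: those of
-- length n whose letters are linked along f (w_i ≺ w_{f(i)} for all i).
-- Identities between coefficients are thus reduced to logical
-- equivalences between admissibility statements (χ-cong, χ-×).  Product
-- and coproduct rule both rest on one splitting principle (Linked-split):
-- if the positions of a word are covered by two index families that f
-- maps to themselves, linkedness along f splits into linkedness of the two
-- subwords.  For the product the families are the first m and the last n
-- positions; for the coproduct they are the positions outside and inside
-- a subset I, and f respects them exactly when I is a union of cycles,
-- which admissibility forces because no B-letter precedes an A-letter.
-- Sums over factorisations (resp. shuffles) are reindexed by take/drop
-- (resp. by the subset of B-positions, via 'interleave').  Linear
-- independence holds because the graph word of σ occurs in 𝐒^τ only for
-- τ = σ.

open import Defs
open import Data.Nat using (ℕ; zero; suc; _≤_; z≤n; s≤s)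
import Data.Nat as ℕ
import Data.Nat.Properties as ℕP
open import Data.Integer using (ℤ; 0ℤ; 1ℤ) renaming (_+_ to _+ℤ_; _*_ to _*ℤ_)
import Data.Integer.Properties as ℤP
open import Data.Bool using (true; false; if_then_else_; not)
import Data.Fin as F
open import Data.Fin using (Fin; toℕ; cast; _↑ˡ_; _↑ʳ_; splitAt; join)
open import Data.Fin.Properties
  using (all?; any?; toℕ-cast; toℕ<n; toℕ-↑ˡ; toℕ-↑ʳ; splitAt-↑ˡ; splitAt-↑ʳ; splitAt⁻¹-↑ˡ; splitAt⁻¹-↑ʳ)
open import Data.Fin.Permutation using (Permutation′; _⟨$⟩ʳ_; _⟨$⟩ˡ_; inverseˡ; inverseʳ)
open import Data.Fin.Subset using (Subset; ∁)
open import Data.Vec using ([]; _∷_; lookup)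
open import Data.Vec.Properties using (lookup-map)
open import Algebra.Properties.CommutativeMonoid.Sum ℕP.+-0-commutativeMonoid using (sum; sum-permute)
open import Data.List using (List; []; _∷_; _++_; map; length; take; drop)
import Data.List as L
open import Data.List.Properties
  using (map-∘; map-cong; length-map; length-++; length-take; length-drop; take++drop≡id;
         length-tabulate; lookup-tabulate)
open import Data.List.Relation.Unary.All using (All; []; _∷_)
open import Data.List.Relation.Unary.AllPairs using (AllPairs; []; _∷_)
open import Data.List.Relation.Unary.Any using (here; there; index)
open import Data.List.Relation.Unary.Any.Properties using (lookup-index)
open import Data.List.Membership.Propositional using (_∈_)
open import Data.List.Membership.Propositional.Properties using (∈-map⁺; ∈-map⁻; ∈-++⁻; ∈-lookup)
open import Data.Maybe using (Maybe; just; nothing; maybe′)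
import Data.Maybe as Maybe
open import Data.Maybe.Properties using (just-injective)
open import Data.Product using (Σ; ∃; _×_; _,_; proj₁; proj₂)
open import Data.Product.Function.NonDependent.Propositional using (_×-⇔_)
import Data.Sum as Sum
open import Data.Sum using (_⊎_; inj₁; inj₂)
open import Data.Empty using (⊥-elim)
open import Function using (_∘_; _⇔_; mk⇔; Equivalence)
open import Function.Construct.Composition using (_⇔-∘_)
open import Function.Construct.Symmetry using (⇔-sym)
open import Relation.Nullary using (Dec; yes; no; does; ¬_)
open import Relation.Nullary.Decidable using (_×-dec_)
import Relation.Nullary.Decidable as Dec
open import Relation.Binary.PropositionalEquality
import Relation.Binary.Reasoning.Setoid
open import Function.Properties.Equivalence using (⇔-setoid)
open import Level using (0ℓ)

open Equivalence using (to; from)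

module ⇔-Reasoning = Relation.Binary.Reasoning.Setoid (⇔-setoid 0ℓ)

-- Every series
-- 𝐒^f is such an indicator, so identities between series reduce to
-- logical equivalences between the propositions behind them.
χ : ∀ {p} {P : Set p} → Dec P → ℤ
χ d = if does d then 1ℤ else 0ℤ

χ-cong : ∀ {p q} {P : Set p} {Q : Set q} → P ⇔ Q → (p : Dec P) (q : Dec Q) → χ p ≡ χ q
χ-cong P⇔Q (yes _) (yes _) = refl
χ-cong P⇔Q (no  _) (no  _) = refl
χ-cong P⇔Q (yes p) (no ¬q) = ⊥-elim (¬q (to P⇔Q p))
χ-cong P⇔Q (no ¬p) (yes q) = ⊥-elim (¬p (from P⇔Q q))

χ-× : ∀ {p q} {P : Set p} {Q : Set q} (p : Dec P) (q : Dec Q) → χ p *ℤ χ q ≡ χ (p ×-dec q)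
χ-× (yes _) (yes _) = refl
χ-× (yes _) (no  _) = refl
χ-× (no  _) (yes _) = refl
χ-× (no  _) (no  _) = refl

χ-yes : ∀ {p} {P : Set p} → P → (d : Dec P) → χ d ≡ 1ℤ
χ-yes p (yes _) = refl
χ-yes p (no ¬p) = ⊥-elim (¬p p)

χ-no : ∀ {p} {P : Set p} → ¬ P → (d : Dec P) → χ d ≡ 0ℤ
χ-no ¬p (yes p) = ⊥-elim (¬p p)
χ-no ¬p (no _)  = refl

sum-map-∘ : {A B : Set} (g : B → ℤ) (f : A → B) (l : List A) →
            sumℤ (map g (map f l)) ≡ sumℤ (map (g ∘ f) l)
sum-map-∘ g f l = cong sumℤ (sym (map-∘ l))

sum-zero : {A : Set} (g : A → ℤ) (l : List A) → (∀ x → x ∈ l → g x ≡ 0ℤ) → sumℤ (map g l) ≡ 0ℤ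
sum-zero g []      z = refl
sum-zero g (x ∷ l) z = cong₂ _+ℤ_ (z x (here refl)) (sum-zero g l (λ y y∈l → z y (there y∈l)))

sum-cong : {A : Set} (g h : A → ℤ) (l : List A) → (∀ x → g x ≡ h x) → sumℤ (map g l) ≡ sumℤ (map h l)
sum-cong g h l g≗h = cong sumℤ (map-cong g≗h l)

sum-++ : {A : Set} (g : A → ℤ) (l l′ : List A) → sumℤ (map g (l ++ l′)) ≡ sumℤ (map g l) +ℤ sumℤ (map g l′)
sum-++ g []      l′ = sym (ℤP.+-identityˡ _)
sum-++ g (x ∷ l) l′ = trans (cong (g x +ℤ_) (sum-++ g l l′)) (sym (ℤP.+-assoc (g x) _ _))

sum-filter : {A : Set} {P : A → Set} (P? : ∀ x → Dec (P x)) (g : A → ℤ) (l : List A) →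
             sumℤ (map g (L.filter P? l)) ≡ sumℤ (map (λ x → χ (P? x) *ℤ g x) l)
sum-filter P? g []      = refl
sum-filter P? g (x ∷ l) with P? x
... | yes _ = cong₂ _+ℤ_ (sym (ℤP.*-identityˡ (g x))) (sum-filter P? g l)
... | no  _ = trans (sum-filter P? g l) (sym (ℤP.+-identityˡ _))

-- Positional access to a word by a natural-number index; unlike
-- 'L.lookup' it is insensitive to how the length of the word is known.

_‼_ : {X : Set} → List X → ℕ → Maybe X
[]       ‼ _     = nothing
(x ∷ xs) ‼ zero  = just x
(x ∷ xs) ‼ suc k = xs ‼ k

‼-lookup : {X : Set} (w : List X) (i : Fin (length w)) → w ‼ toℕ i ≡ just (L.lookup w i)
‼-lookup (x ∷ w) F.zero    = refl
‼-lookup (x ∷ w) (F.suc i) = ‼-lookup w i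

‼-++ˡ : {X : Set} (u v : List X) (k : ℕ) → k ℕ.< length u → (u ++ v) ‼ k ≡ u ‼ k
‼-++ˡ (x ∷ u) v zero    _   = refl
‼-++ˡ (x ∷ u) v (suc k) k<u = ‼-++ˡ u v k (ℕP.≤-pred k<u)

‼-++ʳ : {X : Set} (u v : List X) (k : ℕ) → (u ++ v) ‼ (length u ℕ.+ k) ≡ v ‼ k
‼-++ʳ []      v k = refl
‼-++ʳ (x ∷ u) v k = ‼-++ʳ u v k

letter : {X : Set} {n : ℕ} (w : List X) → length w ≡ n → Fin n → X
letter w e i = L.lookup w (cast (sym e) i)

letter-‼ : {X : Set} {n : ℕ} (w : List X) (e : length w ≡ n) (i : Fin n) →
           w ‼ toℕ i ≡ just (letter w e i)
letter-‼ w e i = trans (cong (w ‼_) (sym (toℕ-cast (sym e) i))) (‼-lookup w (cast (sym e) i))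

letter-from-‼ : {X : Set} {n : ℕ} (w : List X) (e : length w ≡ n) (i : Fin n) {x : X} →
                w ‼ toℕ i ≡ just x → letter w e i ≡ x
letter-from-‼ w e i eq = just-injective (trans (sym (letter-‼ w e i)) eq)

-- 'Linked R W f': every letter of the word W : [n] → X is R-related to
-- the letter at its image under f.  A word appears in 𝐒^f exactly when
-- it is linked along f.
Linked : {X : Set} {n : ℕ} → (X → X → Set) → (Fin n → X) → (Fin n → Fin n) → Set
Linked R W f = ∀ i → R (W i) (W (f i))

Linked-≗ : {X : Set} {n : ℕ} (R : X → X → Set) {W W′ : Fin n → X} (f : Fin n → Fin n) →
           (∀ i → W i ≡ W′ i) → Linked R W f ⇔ Linked R W′ f
Linked-≗ R f W≗W′ = mk⇔ (λ l i → subst₂ R (W≗W′ i) (W≗W′ (f i)) (l i))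
                        (λ l i → subst₂ R (sym (W≗W′ i)) (sym (W≗W′ (f i))) (l i))

Linked-split : {X : Set} (R : X → X → Set) {N a b : ℕ} (W : Fin N → X) (f : Fin N → Fin N)
               {f₁ : Fin a → Fin a} {f₂ : Fin b → Fin b}
               (ι₁ : Fin a → Fin N) (ι₂ : Fin b → Fin N) →
               (∀ p → (∃ λ x → ι₁ x ≡ p) ⊎ (∃ λ y → ι₂ y ≡ p)) →
               (∀ x → f (ι₁ x) ≡ ι₁ (f₁ x)) → (∀ y → f (ι₂ y) ≡ ι₂ (f₂ y)) →
               Linked R W f ⇔ (Linked R (W ∘ ι₁) f₁ × Linked R (W ∘ ι₂) f₂)
Linked-split R W f {f₁} {f₂} ι₁ ι₂ cover f∘ι₁ f∘ι₂ = mk⇔ restrict glue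
  where
  restrict : Linked R W f → Linked R (W ∘ ι₁) f₁ × Linked R (W ∘ ι₂) f₂
  restrict l = (λ x → subst (R (W (ι₁ x)) ∘ W) (f∘ι₁ x) (l (ι₁ x)))
             , (λ y → subst (R (W (ι₂ y)) ∘ W) (f∘ι₂ y) (l (ι₂ y)))

  glue : Linked R (W ∘ ι₁) f₁ × Linked R (W ∘ ι₂) f₂ → Linked R W f
  glue (l₁ , l₂) p with cover p
  ... | inj₁ (x , refl) = subst (R (W (ι₁ x)) ∘ W) (sym (f∘ι₁ x)) (l₁ x)
  ... | inj₂ (y , refl) = subst (R (W (ι₂ y)) ∘ W) (sym (f∘ι₂ y)) (l₂ y)

module Admissibility {X : Set} (R : X → X → Set) (R? : ∀ x y → Dec (R x y)) where

  Admissible : {n : ℕ} → (Fin n → Fin n) → List X → Set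
  Admissible {n} f w = Σ (length w ≡ n) λ e → Linked R (letter w e) f

  -- The length proof is irrelevant, so any known one may be used.
  admissible-at : {n : ℕ} (f : Fin n → Fin n) (w : List X) (e : length w ≡ n) →
                  Admissible f w ⇔ Linked R (letter w e) f
  admissible-at f w e =
    mk⇔ (λ (e′ , l) → subst (λ e → Linked R (letter w e) f) (ℕP.≡-irrelevant e′ e) l) (e ,_)

  admissible? : {n : ℕ} (f : Fin n → Fin n) (w : List X) → Dec (Admissible f w)
  admissible? {n} f w with length w ℕ.≟ n
  ... | no ≢n = no (≢n ∘ proj₁)
  ... | yes e = Dec.map (⇔-sym (admissible-at f w e)) (all? λ i → R? (letter w e i) (letter w e (f i)))

  SGen-χ : {n : ℕ} (f : Fin n → Fin n) (w : List X) → SGen R R? f w ≡ χ (admissible? f w)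
  SGen-χ {n} f w with length w ℕ.≟ n
  ... | no _  = refl
  ... | yes _ = refl

  SGen-× : {m n : ℕ} (f : Fin m → Fin m) (g : Fin n → Fin n) (u v : List X) →
           SGen R R? f u *ℤ SGen R R? g v ≡ χ (admissible? f u ×-dec admissible? g v)
  SGen-× f g u v = trans (cong₂ _*ℤ_ (SGen-χ f u) (SGen-χ g v)) (χ-× (admissible? f u) (admissible? g v))

  SGen-length : {n : ℕ} (f : Fin n → Fin n) (w : List X) → length w ≢ n → SGen R R? f w ≡ 0ℤ
  SGen-length f w ≢n = trans (SGen-χ f w) (χ-no (≢n ∘ proj₁) (admissible? f w))

_∷ˡ_ : {X : Set} → X → List X × List X → List X × List X
x ∷ˡ (u , v) = (x ∷ u , v)

splits-take-drop : {X : Set} (m : ℕ) (h : List X × List X → ℤ) →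
                   (∀ u v → length u ≢ m → h (u , v) ≡ 0ℤ) →
                   (w : List X) → sumℤ (map h (splits w)) ≡ h (take m w , drop m w)
splits-take-drop zero    h vanish []       = ℤP.+-identityʳ _
splits-take-drop (suc m) h vanish []       = ℤP.+-identityʳ _
splits-take-drop zero    h vanish (x ∷ w) = begin
  h ([] , x ∷ w) +ℤ sumℤ (map h (map (x ∷ˡ_) (splits w)))  ≡⟨ cong (h ([] , x ∷ w) +ℤ_) rest ⟩
  h ([] , x ∷ w) +ℤ 0ℤ                                ≡⟨ ℤP.+-identityʳ _ ⟩
  h ([] , x ∷ w)                                      ∎
  where
  open ≡-Reasoning
  rest : sumℤ (map h (map (x ∷ˡ_) (splits w))) ≡ 0ℤ
  rest = trans (sum-map-∘ h _ (splits w)) (sum-zero _ (splits w) λ p _ → vanish _ _ λ ())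
splits-take-drop (suc m) h vanish (x ∷ w) = begin
  h ([] , x ∷ w) +ℤ sumℤ (map h (map (x ∷ˡ_) (splits w)))  ≡⟨ cong (_+ℤ rest) (vanish [] (x ∷ w) λ ()) ⟩
  0ℤ +ℤ sumℤ (map h (map (x ∷ˡ_) (splits w)))              ≡⟨ ℤP.+-identityˡ _ ⟩
  sumℤ (map h (map (x ∷ˡ_) (splits w)))                    ≡⟨ sum-map-∘ h _ (splits w) ⟩
  sumℤ (map (h ∘ (x ∷ˡ_)) (splits w))                      ≡⟨ splits-take-drop m (h ∘ (x ∷ˡ_)) vanish′ w ⟩
  h (x ∷ take m w , drop m w)                              ∎
  where
  open ≡-Reasoning
  rest : ℤ
  rest = sumℤ (map h (map (x ∷ˡ_) (splits w)))
  vanish′ : ∀ u v → length u ≢ m → h (x ∷ u , v) ≡ 0ℤ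
  vanish′ u v ≢m = vanish (x ∷ u) v (≢m ∘ ℕP.suc-injective)

-- Shifted concatenation σ • τ acts as σ on the first m positions and as
-- τ (shifted) on the last n; by the splitting principle this gives the
-- product rule, over any alphabet.
module Concatenation {X : Set} (R : X → X → Set) (R? : ∀ x y → Dec (R x y))
                     {m n : ℕ} (σ : Permutation′ m) (τ : Permutation′ n) where
  open Admissibility R R?

  •-↑ˡ : ∀ i → (σ • τ) ⟨$⟩ʳ (i ↑ˡ n) ≡ (σ ⟨$⟩ʳ i) ↑ˡ n
  •-↑ˡ i = cong (join m n ∘ Sum.map (σ ⟨$⟩ʳ_) (τ ⟨$⟩ʳ_)) (splitAt-↑ˡ m i n)

  •-↑ʳ : ∀ j → (σ • τ) ⟨$⟩ʳ (m ↑ʳ j) ≡ m ↑ʳ (τ ⟨$⟩ʳ j)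
  •-↑ʳ j = cong (join m n ∘ Sum.map (σ ⟨$⟩ʳ_) (τ ⟨$⟩ʳ_)) (splitAt-↑ʳ m n j)

  ↑-cover : ∀ p → (∃ λ i → i ↑ˡ n ≡ p) ⊎ (∃ λ j → m ↑ʳ j ≡ p)
  ↑-cover p with splitAt m p in eq
  ... | inj₁ i = inj₁ (i , splitAt⁻¹-↑ˡ eq)
  ... | inj₂ j = inj₂ (j , splitAt⁻¹-↑ʳ eq)

  module _ (u v : List X) (e : length (u ++ v) ≡ m ℕ.+ n) (e₁ : length u ≡ m) (e₂ : length v ≡ n) where

    letter-↑ˡ : ∀ i → letter (u ++ v) e (i ↑ˡ n) ≡ letter u e₁ i
    letter-↑ˡ i = letter-from-‼ (u ++ v) e (i ↑ˡ n) (begin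
      (u ++ v) ‼ toℕ (i ↑ˡ n)  ≡⟨ cong ((u ++ v) ‼_) (toℕ-↑ˡ i n) ⟩
      (u ++ v) ‼ toℕ i         ≡⟨ ‼-++ˡ u v (toℕ i) (subst (toℕ i ℕ.<_) (sym e₁) (toℕ<n i)) ⟩
      u ‼ toℕ i                ≡⟨ letter-‼ u e₁ i ⟩
      just (letter u e₁ i)     ∎)
      where open ≡-Reasoning

    letter-↑ʳ : ∀ j → letter (u ++ v) e (m ↑ʳ j) ≡ letter v e₂ j
    letter-↑ʳ j = letter-from-‼ (u ++ v) e (m ↑ʳ j) (begin
      (u ++ v) ‼ toℕ (m ↑ʳ j)         ≡⟨ cong ((u ++ v) ‼_) (toℕ-↑ʳ m j) ⟩
      (u ++ v) ‼ (m ℕ.+ toℕ j)        ≡⟨ cong (λ k → (u ++ v) ‼ (k ℕ.+ toℕ j)) (sym e₁) ⟩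
      (u ++ v) ‼ (length u ℕ.+ toℕ j) ≡⟨ ‼-++ʳ u v (toℕ j) ⟩
      v ‼ toℕ j                        ≡⟨ letter-‼ v e₂ j ⟩
      just (letter v e₂ j)             ∎)
      where open ≡-Reasoning

    linked-++ : Linked R (letter (u ++ v) e) ((σ • τ) ⟨$⟩ʳ_)
              ⇔ (Linked R (letter u e₁) (σ ⟨$⟩ʳ_) × Linked R (letter v e₂) (τ ⟨$⟩ʳ_))
    linked-++ = (Linked-≗ R _ letter-↑ˡ ×-⇔ Linked-≗ R _ letter-↑ʳ)
            ⇔-∘ Linked-split R _ _ (_↑ˡ n) (m ↑ʳ_) ↑-cover •-↑ˡ •-↑ʳ

  admissible-• : (w : List X) →
                 Admissible ((σ • τ) ⟨$⟩ʳ_) w ⇔ (Admissible (σ ⟨$⟩ʳ_) (take m w) × Admissible (τ ⟨$⟩ʳ_) (drop m w))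
  admissible-• w with length (take m w) ℕ.≟ m | length (drop m w) ℕ.≟ n
  ... | no ≢m | _ = mk⇔ (λ (e , _) → ⊥-elim (≢m (length-take-≡ e))) (λ ((e₁ , _) , _) → ⊥-elim (≢m e₁))
    where
    length-take-≡ : length w ≡ m ℕ.+ n → length (take m w) ≡ m
    length-take-≡ e = trans (length-take m w) (trans (cong (m ℕ.⊓_) e) (ℕP.m≤n⇒m⊓n≡m (ℕP.m≤m+n m n)))
  ... | yes _ | no ≢n = mk⇔ (λ (e , _) → ⊥-elim (≢n (length-drop-≡ e))) (λ (_ , (e₂ , _)) → ⊥-elim (≢n e₂))
    where
    length-drop-≡ : length w ≡ m ℕ.+ n → length (drop m w) ≡ n
    length-drop-≡ e = trans (length-drop m w) (trans (cong (ℕ._∸ m) e) (ℕP.m+n∸m≡n m n))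
  ... | yes e₁ | yes e₂ = begin
    Admissible ((σ • τ) ⟨$⟩ʳ_) w                        ≡⟨ cong (Admissible _) (sym (take++drop≡id m w)) ⟩
    Admissible ((σ • τ) ⟨$⟩ʳ_) (u ++ v)                 ≈⟨ admissible-at _ (u ++ v) e ⟩
    Linked R (letter (u ++ v) e) ((σ • τ) ⟨$⟩ʳ_)        ≈⟨ linked-++ u v e e₁ e₂ ⟩
    (Linked R (letter u e₁) _ × Linked R (letter v e₂) _) ≈⟨ admissible-at _ u e₁ ×-⇔ admissible-at _ v e₂ ⟨
    (Admissible (σ ⟨$⟩ʳ_) u × Admissible (τ ⟨$⟩ʳ_) v)    ∎
    where
    open ⇔-Reasoning
    u v : List X
    u = take m w
    v = drop m w
    e : length (u ++ v) ≡ m ℕ.+ n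
    e = trans (length-++ u) (cong₂ ℕ._+_ e₁ e₂)

  product-rule : (w : List X) →
                 (SGen R R? (σ ⟨$⟩ʳ_) ⊛ SGen R R? (τ ⟨$⟩ʳ_)) w ≡ SGen R R? ((σ • τ) ⟨$⟩ʳ_) w
  product-rule w = begin
    (Sσ ⊛ Sτ) w                                       ≡⟨ splits-take-drop m _ vanish w ⟩
    Sσ (take m w) *ℤ Sτ (drop m w)                    ≡⟨ SGen-× _ _ (take m w) (drop m w) ⟩
    χ (admσ ×-dec admτ)                               ≡⟨ χ-cong (⇔-sym (admissible-• w)) (admσ ×-dec admτ) (admissible? _ w) ⟩
    χ (admissible? ((σ • τ) ⟨$⟩ʳ_) w)                 ≡⟨ SGen-χ _ w ⟨
    SGen R R? ((σ • τ) ⟨$⟩ʳ_) w                       ∎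
    where
    open ≡-Reasoning
    Sσ Sτ : Series X
    Sσ = SGen R R? (σ ⟨$⟩ʳ_)
    Sτ = SGen R R? (τ ⟨$⟩ʳ_)
    admσ : Dec (Admissible (σ ⟨$⟩ʳ_) (take m w))
    admσ = admissible? _ (take m w)
    admτ : Dec (Admissible (τ ⟨$⟩ʳ_) (drop m w))
    admτ = admissible? _ (drop m w)
    vanish : ∀ u v → length u ≢ m → Sσ u *ℤ Sτ v ≡ 0ℤ
    vanish u v ≢m = cong (_*ℤ Sτ v) (SGen-length _ u ≢m)

unit-rule : (w : List Letter) → 𝐒 ε₀ w ≡ oneS w
unit-rule []      = refl
unit-rule (_ ∷ _) = refl

-- Linear independence.  The graph word (0,σ(0)) (1,σ(1)) ⋯ of σ occurs
-- in 𝐒^τ only when τ = σ, so evaluating a linear combination at it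
-- isolates the coefficient of 𝐒^σ.

graphLetter : {n : ℕ} → Permutation′ n → Fin n → Letter
graphLetter σ i = (toℕ i , toℕ (σ ⟨$⟩ʳ i))

graphWord : {n : ℕ} → Permutation′ n → List Letter
graphWord σ = L.tabulate (graphLetter σ)

module _ where
  open Admissibility _≺_ _≺?_

  letter-graphWord : {n : ℕ} (σ : Permutation′ n) (e : length (graphWord σ) ≡ n) (i : Fin n) →
                     letter (graphWord σ) e i ≡ graphLetter σ i
  letter-graphWord σ e i =
    subst (λ e → letter (graphWord σ) e i ≡ graphLetter σ i) (ℕP.≡-irrelevant (length-tabulate (graphLetter σ)) e)
          (lookup-tabulate (graphLetter σ) i)

  𝐒-graphWord-self : {n : ℕ} (σ : Permutation′ n) → 𝐒 σ (graphWord σ) ≡ 1ℤ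
  𝐒-graphWord-self {n} σ = trans (SGen-χ _ (graphWord σ)) (χ-yes (e , linked) (admissible? _ (graphWord σ)))
    where
    e : length (graphWord σ) ≡ n
    e = length-tabulate (graphLetter σ)
    linked : Linked _≺_ (letter (graphWord σ) e) (σ ⟨$⟩ʳ_)
    linked i = subst₂ _≺_ (sym (letter-graphWord σ e i)) (sym (letter-graphWord σ e (σ ⟨$⟩ʳ i))) refl

  graphWord-admissible⇒code : {n n′ : ℕ} (σ : Permutation′ n) (τ : Permutation′ n′) →
                              Admissible (τ ⟨$⟩ʳ_) (graphWord σ) → code (n′ , τ) ≡ code (n , σ)
  graphWord-admissible⇒code {n} σ τ (e , linked) with trans (sym (length-tabulate (graphLetter σ))) e
  ... | refl = map-cong τ≗σ (L.allFin n)
    where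
    τ≗σ : ∀ i → toℕ (τ ⟨$⟩ʳ i) ≡ toℕ (σ ⟨$⟩ʳ i)
    τ≗σ i = sym (subst₂ _≺_ (letter-graphWord σ e i) (letter-graphWord σ e (τ ⟨$⟩ʳ i)) (linked i))

  𝐒-graphWord-other : {n n′ : ℕ} (σ : Permutation′ n) (τ : Permutation′ n′) →
                      code (n′ , τ) ≢ code (n , σ) → 𝐒 τ (graphWord σ) ≡ 0ℤ
  𝐒-graphWord-other σ τ ≢ = trans (SGen-χ _ (graphWord σ))
    (χ-no (≢ ∘ graphWord-admissible⇒code σ τ) (admissible? _ (graphWord σ)))

evalComb-graphWord : {n : ℕ} (σ : Permutation′ n) (L : List (Perm × ℤ)) →
                     All (λ t → code (n , σ) ≢ code (proj₁ t)) L → evalComb L (graphWord σ) ≡ 0ℤ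
evalComb-graphWord σ []                    []         = refl
evalComb-graphWord σ (((n′ , τ) , c) ∷ L) (≢ ∷ ≢s) = begin
  c *ℤ 𝐒 τ (graphWord σ) +ℤ evalComb L (graphWord σ)  ≡⟨ cong₂ (λ s r → c *ℤ s +ℤ r) (𝐒-graphWord-other σ τ (≢ ∘ sym))
                                                                                   (evalComb-graphWord σ L ≢s) ⟩
  c *ℤ 0ℤ +ℤ 0ℤ                                       ≡⟨ cong (_+ℤ 0ℤ) (ℤP.*-zeroʳ c) ⟩
  0ℤ                                                   ∎
  where open ≡-Reasoning

linear-independence : (L : List (Perm × ℤ)) →
                      AllPairs (λ s t → code (proj₁ s) ≢ code (proj₁ t)) L →
                      ((w : List Letter) → evalComb L w ≡ 0ℤ) →
                      All (λ t → proj₂ t ≡ 0ℤ) L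
linear-independence []                    []               vanish = []
linear-independence (((n , σ) , c) ∷ L) (fresh ∷ distinct) vanish =
  c≡0 ∷ linear-independence L distinct vanish′
  where
  open ≡-Reasoning
  c≡0 : c ≡ 0ℤ
  c≡0 = begin
    c                                                    ≡⟨ ℤP.*-identityʳ c ⟨
    c *ℤ 1ℤ                                              ≡⟨ cong (c *ℤ_) (𝐒-graphWord-self σ) ⟨
    c *ℤ 𝐒 σ (graphWord σ)                               ≡⟨ ℤP.+-identityʳ _ ⟨
    c *ℤ 𝐒 σ (graphWord σ) +ℤ 0ℤ                         ≡⟨ cong (c *ℤ 𝐒 σ (graphWord σ) +ℤ_) (evalComb-graphWord σ L fresh) ⟨
    c *ℤ 𝐒 σ (graphWord σ) +ℤ evalComb L (graphWord σ)   ≡⟨ vanish (graphWord σ) ⟩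
    0ℤ                                                   ∎
  vanish′ : (w : List Letter) → evalComb L w ≡ 0ℤ
  vanish′ w = begin
    evalComb L w                          ≡⟨ ℤP.+-identityˡ _ ⟨
    0ℤ *ℤ 𝐒 σ w +ℤ evalComb L w           ≡⟨ cong (λ c → c *ℤ 𝐒 σ w +ℤ evalComb L w) c≡0 ⟨
    c *ℤ 𝐒 σ w +ℤ evalComb L w            ≡⟨ vanish w ⟩
    0ℤ                                    ∎

∈∁⇒∉ : {n : ℕ} (I : Subset n) (p : Fin n) → p ∈ₛ ∁ I → lookup I p ≡ false
∈∁⇒∉ I p p∈∁I with lookup I p | lookup-map p not I
... | false | _ = refl
... | true  | eq with () ← trans (sym p∈∁I) eq

∉⇒∈∁ : {n : ℕ} (I : Subset n) (p : Fin n) → lookup I p ≡ false → p ∈ₛ ∁ I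
∉⇒∈∁ I p p∉I = trans (lookup-map p not I) (cong not p∉I)

-- A subset mapped into itself by a permutation σ is a union of cycles of
-- σ.  Counting argument: its indicator ind satisfies ind ≤ ind ∘ σ, and
-- both have the same sum, hence ind = ind ∘ σ.

sum-mono : {n : ℕ} (g h : Fin n → ℕ) → (∀ p → g p ≤ h p) → sum g ≤ sum h
sum-mono {zero}  g h g≤h = z≤n
sum-mono {suc n} g h g≤h = ℕP.+-mono-≤ (g≤h F.zero) (sum-mono (g ∘ F.suc) (h ∘ F.suc) (g≤h ∘ F.suc))

sum-≤-≡ : {n : ℕ} (g h : Fin n → ℕ) → (∀ p → g p ≤ h p) → sum g ≡ sum h → ∀ p → g p ≡ h p
sum-≤-≡ {suc n} g h g≤h Σg≡Σh = pointwise
  where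
  head≡ : g F.zero ≡ h F.zero
  head≡ = ℕP.≤-antisym (g≤h F.zero)
    (ℕP.+-cancelʳ-≤ (sum (h ∘ F.suc)) (h F.zero) (g F.zero)
      (subst (ℕ._≤ g F.zero ℕ.+ sum (h ∘ F.suc)) Σg≡Σh
        (ℕP.+-monoʳ-≤ (g F.zero) (sum-mono (g ∘ F.suc) (h ∘ F.suc) (g≤h ∘ F.suc)))))
  tail≡ : sum (g ∘ F.suc) ≡ sum (h ∘ F.suc)
  tail≡ = ℕP.+-cancelˡ-≡ (g F.zero) _ _ (trans Σg≡Σh (cong (ℕ._+ sum (h ∘ F.suc)) (sym head≡)))
  pointwise : ∀ p → g p ≡ h p
  pointwise F.zero    = head≡
  pointwise (F.suc p) = sum-≤-≡ (g ∘ F.suc) (h ∘ F.suc) (g≤h ∘ F.suc) tail≡ p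

indicator : {n : ℕ} → Subset n → Fin n → ℕ
indicator I p = if lookup I p then 1 else 0

indicator-1⇒∈ : {n : ℕ} (I : Subset n) (p : Fin n) → indicator I p ≡ 1 → p ∈ₛ I
indicator-1⇒∈ I p ind≡1 with lookup I p
... | true  = refl
... | false with () ← ind≡1

forward-closed⇒union-of-cycles : {n : ℕ} (σ : Permutation′ n) (I : Subset n) →
                                 (∀ p → p ∈ₛ I → (σ ⟨$⟩ʳ p) ∈ₛ I) → IsUnionOfCycles σ I
forward-closed⇒union-of-cycles σ I closed = closed , backward
  where
  ind≤ind∘σ : ∀ p → indicator I p ≤ indicator I (σ ⟨$⟩ʳ p)
  ind≤ind∘σ p with lookup I p in p∈I
  ... | false = z≤n
  ... | true  rewrite closed p p∈I = s≤s z≤n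

  ind≡ind∘σ : ∀ p → indicator I p ≡ indicator I (σ ⟨$⟩ʳ p)
  ind≡ind∘σ = sum-≤-≡ _ _ ind≤ind∘σ (sum-permute (indicator I) σ)

  backward : ∀ p → p ∈ₛ I → (σ ⟨$⟩ˡ p) ∈ₛ I
  backward p p∈I = indicator-1⇒∈ I (σ ⟨$⟩ˡ p) (begin
    indicator I (σ ⟨$⟩ˡ p)                 ≡⟨ ind≡ind∘σ (σ ⟨$⟩ˡ p) ⟩
    indicator I (σ ⟨$⟩ʳ (σ ⟨$⟩ˡ p))        ≡⟨ cong (indicator I) (inverseʳ σ) ⟩
    indicator I p                          ≡⟨ cong (λ b → if b then 1 else 0) p∈I ⟩
    1                                      ∎)
    where open ≡-Reasoning

∁-closed : {n : ℕ} (σ : Permutation′ n) (I : Subset n) → IsUnionOfCycles σ I →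
           ∀ p → p ∈ₛ ∁ I → (σ ⟨$⟩ʳ p) ∈ₛ ∁ I
∁-closed σ I (_ , backward) p p∈∁I = ∉⇒∈∁ I (σ ⟨$⟩ʳ p) σp∉I
  where
  σp∉I : lookup I (σ ⟨$⟩ʳ p) ≡ false
  σp∉I with lookup I (σ ⟨$⟩ʳ p) in σp∈I
  ... | false = refl
  ... | true  with () ← trans (sym (∈∁⇒∉ I p p∈∁I)) (subst (_∈ₛ I) (inverseˡ σ) (backward _ σp∈I))

elems-sound : {n : ℕ} (I : Subset n) {p : Fin n} → p ∈ elems I → p ∈ₛ I
elems-sound (true  ∷ I) (here refl) = refl
elems-sound (true  ∷ I) (there p∈)  with ∈-map⁻ F.suc p∈
... | _ , p′∈ , refl = elems-sound I p′∈
elems-sound (false ∷ I) p∈          with ∈-map⁻ F.suc p∈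
... | _ , p′∈ , refl = elems-sound I p′∈

elems-complete : {n : ℕ} (I : Subset n) (p : Fin n) → p ∈ₛ I → p ∈ elems I
elems-complete (true  ∷ I) F.zero    _   = here refl
elems-complete (true  ∷ I) (F.suc p) p∈I = there (∈-map⁺ F.suc (elems-complete I p p∈I))
elems-complete (false ∷ I) (F.suc p) p∈I = ∈-map⁺ F.suc (elems-complete I p p∈I)

count : {n : ℕ} → Subset n → ℕ
count I = length (elems I)

count-false : {n : ℕ} (I : Subset n) → count (false ∷ I) ≡ count I
count-false I = length-map F.suc (elems I)

count-true : {n : ℕ} (I : Subset n) → count (true ∷ I) ≡ suc (count I)
count-true I = cong suc (length-map F.suc (elems I))

count-∁ : {n : ℕ} (I : Subset n) → count (∁ I) ℕ.+ count I ≡ n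
count-∁ []          = refl
count-∁ {suc n} (false ∷ I) = begin
  count (true ∷ ∁ I) ℕ.+ count (false ∷ I)   ≡⟨ cong₂ ℕ._+_ (count-true (∁ I)) (count-false I) ⟩
  suc (count (∁ I) ℕ.+ count I)              ≡⟨ cong suc (count-∁ I) ⟩
  suc n                                       ∎
  where open ≡-Reasoning
count-∁ {suc n} (true ∷ I) = begin
  count (false ∷ ∁ I) ℕ.+ count (true ∷ I)   ≡⟨ cong₂ ℕ._+_ (count-false (∁ I)) (count-true I) ⟩
  count (∁ I) ℕ.+ suc (count I)              ≡⟨ ℕP.+-suc (count (∁ I)) (count I) ⟩
  suc (count (∁ I) ℕ.+ count I)              ≡⟨ cong suc (count-∁ I) ⟩
  suc n                                       ∎
  where open ≡-Reasoning

position : {n : ℕ} (I : Subset n) → Fin (count I) → Fin n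
position I = L.lookup (elems I)

position-∈ : {n : ℕ} (I : Subset n) (x : Fin (count I)) → position I x ∈ₛ I
position-∈ I x = elems-sound I (∈-lookup x)

position-onto : {n : ℕ} (I : Subset n) (p : Fin n) → p ∈ₛ I → ∃ λ x → position I x ≡ p
position-onto I p p∈I = index p∈elems , sym (lookup-index p∈elems)
  where
  p∈elems : p ∈ elems I
  p∈elems = elems-complete I p p∈I

interleave : {n : ℕ} → Subset n → List Letter → List Letter → Maybe (List LetterAB)
interleave []          []      []      = just []
interleave (false ∷ I) (x ∷ u) v       = Maybe.map (inj₁ x ∷_) (interleave I u v)
interleave (true  ∷ I) u       (y ∷ v) = Maybe.map (inj₂ y ∷_) (interleave I u v)
interleave _           _       _       = nothing

map-just⁻ : {A B : Set} (f : A → B) (m : Maybe A) {y : B} → Maybe.map f m ≡ just y → ∃ λ x → m ≡ just x × f x ≡ y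
map-just⁻ f (just x) refl = x , refl , refl

‼-map⁻ : {A B : Set} (f : A → B) (l : List A) (k : ℕ) {y : B} → map f l ‼ k ≡ just y →
         ∃ λ x → l ‼ k ≡ just x × f x ≡ y
‼-map⁻ f (x ∷ l) zero    refl = x , refl , refl
‼-map⁻ f (x ∷ l) (suc k) eq   = ‼-map⁻ f l k eq

interleave-length : {n : ℕ} (I : Subset n) (u v : List Letter) {w : List LetterAB} →
                    interleave I u v ≡ just w →
                    length u ≡ count (∁ I) × length v ≡ count I × length w ≡ n
interleave-length []          []      []      refl = refl , refl , refl
interleave-length (false ∷ I) (x ∷ u) v       eq with map-just⁻ _ (interleave I u v) eq
... | _ , eq′ , refl with interleave-length I u v eq′
...   | eu , ev , ew = trans (cong suc eu) (sym (count-true (∁ I))) , trans ev (sym (count-false I)) , cong suc ew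
interleave-length (true  ∷ I) u       (y ∷ v) eq with map-just⁻ _ (interleave I u v) eq
... | _ , eq′ , refl with interleave-length I u v eq′
...   | eu , ev , ew = trans eu (sym (count-false (∁ I))) , trans (cong suc ev) (sym (count-true I)) , cong suc ew

interleave-defined : {n : ℕ} (I : Subset n) (u v : List Letter) →
                     length u ≡ count (∁ I) → length v ≡ count I → ∃ λ w → interleave I u v ≡ just w
interleave-defined []          []      []      _  _  = [] , refl
interleave-defined (false ∷ I) (x ∷ u) v       eu ev with
  interleave-defined I u v (trans (ℕP.suc-injective eu) (count-false (∁ I))) (trans ev (count-false I))
... | w , eq = inj₁ x ∷ w , cong (Maybe.map (inj₁ x ∷_)) eq
interleave-defined (true  ∷ I) u       (y ∷ v) eu ev with
  interleave-defined I u v (trans eu (count-false (∁ I))) (trans (ℕP.suc-injective ev) (count-false I))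
... | w , eq = inj₂ y ∷ w , cong (Maybe.map (inj₂ y ∷_)) eq
interleave-defined (false ∷ I) []      v       () _
interleave-defined (true  ∷ I) u       []      _  ()

interleave-‼ᴮ : {n : ℕ} (I : Subset n) (u v : List Letter) {w : List LetterAB} →
                interleave I u v ≡ just w → ∀ k {p} → elems I ‼ k ≡ just p → w ‼ toℕ p ≡ Maybe.map inj₂ (v ‼ k)
interleave-‼ᴮ (false ∷ I) (x ∷ u) v       eq k       ek with map-just⁻ _ (interleave I u v) eq | ‼-map⁻ F.suc (elems I) k ek
... | _ , eq′ , refl | _ , ek′ , refl = interleave-‼ᴮ I u v eq′ k ek′
interleave-‼ᴮ (true  ∷ I) u       (y ∷ v) eq zero    refl with map-just⁻ _ (interleave I u v) eq
... | _ , _ , refl = refl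
interleave-‼ᴮ (true  ∷ I) u       (y ∷ v) eq (suc k) ek with map-just⁻ _ (interleave I u v) eq | ‼-map⁻ F.suc (elems I) k ek
... | _ , eq′ , refl | _ , ek′ , refl = interleave-‼ᴮ I u v eq′ k ek′

interleave-‼ᴬ : {n : ℕ} (I : Subset n) (u v : List Letter) {w : List LetterAB} →
                interleave I u v ≡ just w → ∀ k {p} → elems (∁ I) ‼ k ≡ just p → w ‼ toℕ p ≡ Maybe.map inj₁ (u ‼ k)
interleave-‼ᴬ (true  ∷ I) u       (y ∷ v) eq k       ek with map-just⁻ _ (interleave I u v) eq | ‼-map⁻ F.suc (elems (∁ I)) k ek
... | _ , eq′ , refl | _ , ek′ , refl = interleave-‼ᴬ I u v eq′ k ek′
interleave-‼ᴬ (false ∷ I) (x ∷ u) v       eq zero    refl with map-just⁻ _ (interleave I u v) eq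
... | _ , _ , refl = refl
interleave-‼ᴬ (false ∷ I) (x ∷ u) v       eq (suc k) ek with map-just⁻ _ (interleave I u v) eq | ‼-map⁻ F.suc (elems (∁ I)) k ek
... | _ , eq′ , refl | _ , ek′ , refl = interleave-‼ᴬ I u v eq′ k ek′

⟦_⟧ : {X : Set} → Series X → Maybe (List X) → ℤ
⟦ F ⟧ = maybe′ F 0ℤ

⟦⟧-map : {X : Set} (F : Series X) (g : List X → List X) (m : Maybe (List X)) →
         ⟦ F ⟧ (Maybe.map g m) ≡ ⟦ F ∘ g ⟧ m
⟦⟧-map F g (just _) = refl
⟦⟧-map F g nothing  = refl

sum-allSubsets-suc : (k : ℕ) (G : Subset (suc k) → ℤ) →
                     sumℤ (map G (allSubsets (suc k)))
                     ≡ sumℤ (map (G ∘ (false ∷_)) (allSubsets k)) +ℤ sumℤ (map (G ∘ (true ∷_)) (allSubsets k))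
sum-allSubsets-suc k G =
  trans (sum-++ G (map (false ∷_) (allSubsets k)) (map (true ∷_) (allSubsets k)))
        (cong₂ _+ℤ_ (sum-map-∘ G _ (allSubsets k)) (sum-map-∘ G _ (allSubsets k)))

shuffles-length : (u v : List Letter) {w : List LetterAB} → w ∈ shuffles u v → length w ≡ length u ℕ.+ length v
shuffles-length []      []      (here refl) = refl
shuffles-length []      (y ∷ v) w∈          with ∈-map⁻ (inj₂ y ∷_) w∈
... | _ , w′∈ , refl = cong suc (shuffles-length [] v w′∈)
shuffles-length (x ∷ u) []      w∈          with ∈-map⁻ (inj₁ x ∷_) w∈
... | _ , w′∈ , refl = cong suc (shuffles-length u [] w′∈)
shuffles-length (x ∷ u) (y ∷ v) w∈          with ∈-++⁻ (map (inj₁ x ∷_) (shuffles u (y ∷ v))) w∈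
... | inj₁ w∈ˡ with ∈-map⁻ (inj₁ x ∷_) w∈ˡ
...   | _ , w′∈ , refl = cong suc (shuffles-length u (y ∷ v) w′∈)
shuffles-length (x ∷ u) (y ∷ v) w∈ | inj₂ w∈ʳ with ∈-map⁻ (inj₂ y ∷_) w∈ʳ
...   | _ , w′∈ , refl = trans (cong suc (shuffles-length (x ∷ u) v w′∈)) (sym (ℕP.+-suc (suc (length u)) (length v)))

module _ (F : Series LetterAB) (k : ℕ) where

  ΣA ΣB : List Letter → List Letter → ℤ
  ΣA u v = sumℤ (map (λ I → ⟦ F ⟧ (interleave (false ∷ I) u v)) (allSubsets k))
  ΣB u v = sumℤ (map (λ I → ⟦ F ⟧ (interleave (true ∷ I) u v)) (allSubsets k))

  ΣA-[] : (v : List Letter) → ΣA [] v ≡ 0ℤ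
  ΣA-[] v = sum-zero _ (allSubsets k) λ _ _ → refl

  ΣB-[] : (u : List Letter) → ΣB u [] ≡ 0ℤ
  ΣB-[] u = sum-zero _ (allSubsets k) λ _ _ → refl

  ΣA-∷ : (x : Letter) (u v : List Letter) →
         ΣA (x ∷ u) v ≡ sumℤ (map (λ I → ⟦ F ∘ (inj₁ x ∷_) ⟧ (interleave I u v)) (allSubsets k))
  ΣA-∷ x u v = sum-cong _ _ (allSubsets k) λ I → ⟦⟧-map F _ (interleave I u v)

  ΣB-∷ : (y : Letter) (u v : List Letter) →
         ΣB u (y ∷ v) ≡ sumℤ (map (λ I → ⟦ F ∘ (inj₂ y ∷_) ⟧ (interleave I u v)) (allSubsets k))
  ΣB-∷ y u v = sum-cong _ _ (allSubsets k) λ I → ⟦⟧-map F _ (interleave I u v)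

-- A sum over the shuffles of u and v is a sum over the subsets I ⊆ [n]
-- of the interleavings along I (n = |u| + |v|): a shuffle is determined
-- by the set of positions occupied by B-letters.
shuffles-as-interleavings : (u v : List Letter) (n : ℕ) → length u ℕ.+ length v ≡ n → (F : Series LetterAB) →
  sumℤ (map F (shuffles u v)) ≡ sumℤ (map (λ I → ⟦ F ⟧ (interleave I u v)) (allSubsets n))
shuffles-as-interleavings []      []      zero    refl F = refl
shuffles-as-interleavings []      (y ∷ v) (suc k) eq   F = begin
  sumℤ (map F (map (inj₂ y ∷_) (shuffles [] v)))   ≡⟨ sum-map-∘ F _ (shuffles [] v) ⟩
  sumℤ (map (F ∘ (inj₂ y ∷_)) (shuffles [] v))     ≡⟨ shuffles-as-interleavings [] v k (ℕP.suc-injective eq) _ ⟩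
  _                                                 ≡⟨ ΣB-∷ F k y [] v ⟨
  ΣB F k [] (y ∷ v)                                 ≡⟨ ℤP.+-identityˡ _ ⟨
  0ℤ +ℤ ΣB F k [] (y ∷ v)                           ≡⟨ cong (_+ℤ ΣB F k [] (y ∷ v)) (ΣA-[] F k (y ∷ v)) ⟨
  ΣA F k [] (y ∷ v) +ℤ ΣB F k [] (y ∷ v)            ≡⟨ sum-allSubsets-suc k _ ⟨
  _                                                 ∎
  where open ≡-Reasoning
shuffles-as-interleavings (x ∷ u) []      (suc k) eq   F = begin
  sumℤ (map F (map (inj₁ x ∷_) (shuffles u [])))   ≡⟨ sum-map-∘ F _ (shuffles u []) ⟩
  sumℤ (map (F ∘ (inj₁ x ∷_)) (shuffles u []))     ≡⟨ shuffles-as-interleavings u [] k (ℕP.suc-injective eq) _ ⟩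
  _                                                 ≡⟨ ΣA-∷ F k x u [] ⟨
  ΣA F k (x ∷ u) []                                 ≡⟨ ℤP.+-identityʳ _ ⟨
  ΣA F k (x ∷ u) [] +ℤ 0ℤ                           ≡⟨ cong (ΣA F k (x ∷ u) [] +ℤ_) (ΣB-[] F k (x ∷ u)) ⟨
  ΣA F k (x ∷ u) [] +ℤ ΣB F k (x ∷ u) []            ≡⟨ sum-allSubsets-suc k _ ⟨
  _                                                 ∎
  where open ≡-Reasoning
shuffles-as-interleavings (x ∷ u) (y ∷ v) (suc k) eq   F = begin
  sumℤ (map F (map (inj₁ x ∷_) (shuffles u (y ∷ v)) ++ map (inj₂ y ∷_) (shuffles (x ∷ u) v)))
    ≡⟨ sum-++ F (map (inj₁ x ∷_) (shuffles u (y ∷ v))) _ ⟩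
  sumℤ (map F (map (inj₁ x ∷_) (shuffles u (y ∷ v)))) +ℤ sumℤ (map F (map (inj₂ y ∷_) (shuffles (x ∷ u) v)))
    ≡⟨ cong₂ _+ℤ_ (sum-map-∘ F _ (shuffles u (y ∷ v))) (sum-map-∘ F _ (shuffles (x ∷ u) v)) ⟩
  sumℤ (map (F ∘ (inj₁ x ∷_)) (shuffles u (y ∷ v))) +ℤ sumℤ (map (F ∘ (inj₂ y ∷_)) (shuffles (x ∷ u) v))
    ≡⟨ cong₂ _+ℤ_ (shuffles-as-interleavings u (y ∷ v) k (ℕP.suc-injective eq) _)
                  (shuffles-as-interleavings (x ∷ u) v k eqʳ _) ⟩
  _ ≡⟨ cong₂ _+ℤ_ (ΣA-∷ F k x u (y ∷ v)) (ΣB-∷ F k y (x ∷ u) v) ⟨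
  ΣA F k (x ∷ u) (y ∷ v) +ℤ ΣB F k (x ∷ u) (y ∷ v)
    ≡⟨ sum-allSubsets-suc k _ ⟨
  _ ∎
  where
  open ≡-Reasoning
  eqʳ : suc (length u) ℕ.+ length v ≡ k
  eqʳ = ℕP.suc-injective (trans (sym (ℕP.+-suc (suc (length u)) (length v))) eq)

std-spec : {n : ℕ} (σ : Permutation′ n) (J : Subset n) (x : Fin (count J)) →
           (σ ⟨$⟩ʳ position J x) ∈ₛ J → position J (std σ J x) ≡ σ ⟨$⟩ʳ position J x
std-spec σ J x σx∈J with any? (λ y → position J y F.≟ (σ ⟨$⟩ʳ position J x))
... | yes (_ , eq) = eq
... | no  ∄       = ⊥-elim (∄ (position-onto J _ σx∈J))

module Coproduct {n : ℕ} (σ : Permutation′ n) (I : Subset n) {u v : List Letter} {w : List LetterAB}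
                 (w≡ : interleave I u v ≡ just w) where
  module A  = Admissibility _≺_ _≺?_
  module AB = Admissibility _≺⊕_ _≺⊕?_

  eu : length u ≡ count (∁ I)
  eu = proj₁ (interleave-length I u v w≡)
  ev : length v ≡ count I
  ev = proj₁ (proj₂ (interleave-length I u v w≡))
  ew : length w ≡ n
  ew = proj₂ (proj₂ (interleave-length I u v w≡))

  W : Fin n → LetterAB
  W = letter w ew

  W-A : ∀ x → W (position (∁ I) x) ≡ inj₁ (letter u eu x)
  W-A x = letter-from-‼ w ew _ (begin
    w ‼ toℕ (position (∁ I) x)   ≡⟨ interleave-‼ᴬ I u v w≡ (toℕ x) (‼-lookup (elems (∁ I)) x) ⟩
    Maybe.map inj₁ (u ‼ toℕ x)   ≡⟨ cong (Maybe.map inj₁) (letter-‼ u eu x) ⟩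
    just (inj₁ (letter u eu x))  ∎)
    where open ≡-Reasoning

  W-B : ∀ y → W (position I y) ≡ inj₂ (letter v ev y)
  W-B y = letter-from-‼ w ew _ (begin
    w ‼ toℕ (position I y)       ≡⟨ interleave-‼ᴮ I u v w≡ (toℕ y) (‼-lookup (elems I) y) ⟩
    Maybe.map inj₂ (v ‼ toℕ y)   ≡⟨ cong (Maybe.map inj₂) (letter-‼ v ev y) ⟩
    just (inj₂ (letter v ev y))  ∎)
    where open ≡-Reasoning

  cover : ∀ p → (∃ λ x → position (∁ I) x ≡ p) ⊎ (∃ λ y → position I y ≡ p)
  cover p with lookup I p in p∈?
  ... | true  = inj₂ (position-onto I p p∈?)
  ... | false = inj₁ (position-onto (∁ I) p (∉⇒∈∁ I p p∈?))

  -- No B-letter precedes an A-letter, so linkedness keeps σ inside I.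
  linked⇒closed : Linked _≺⊕_ W (σ ⟨$⟩ʳ_) → ∀ p → p ∈ₛ I → (σ ⟨$⟩ʳ p) ∈ₛ I
  linked⇒closed linked p p∈I with lookup I (σ ⟨$⟩ʳ p) in σp∈?
  ... | true  = refl
  ... | false with position-onto I p p∈I | position-onto (∁ I) (σ ⟨$⟩ʳ p) (∉⇒∈∁ I _ σp∈?)
  ...   | y , refl | x , σp≡ =
    ⊥-elim (subst₂ _≺⊕_ (W-B y) (trans (cong W (sym σp≡)) (W-A x)) (linked (position I y)))

  module _ (cycles : IsUnionOfCycles σ I) where

    σ-A : ∀ x → σ ⟨$⟩ʳ position (∁ I) x ≡ position (∁ I) (std σ (∁ I) x)
    σ-A x = sym (std-spec σ (∁ I) x (∁-closed σ I cycles _ (position-∈ (∁ I) x)))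

    σ-B : ∀ y → σ ⟨$⟩ʳ position I y ≡ position I (std σ I y)
    σ-B y = sym (std-spec σ I y (proj₁ cycles _ (position-∈ I y)))

    linked-⊕ : Linked _≺⊕_ W (σ ⟨$⟩ʳ_)
             ⇔ (Linked _≺_ (letter u eu) (std σ (∁ I)) × Linked _≺_ (letter v ev) (std σ I))
    linked-⊕ = (Linked-≗ _≺⊕_ _ W-A ×-⇔ Linked-≗ _≺⊕_ _ W-B)
           ⇔-∘ Linked-split _≺⊕_ W _ (position (∁ I)) (position I) cover σ-A σ-B

  admissible-⊕ : AB.Admissible (σ ⟨$⟩ʳ_) w
               ⇔ (IsUnionOfCycles σ I × (A.Admissible (std σ (∁ I)) u × A.Admissible (std σ I) v))
  admissible-⊕ = mk⇔ restrict glue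
    where
    restrict : AB.Admissible (σ ⟨$⟩ʳ_) w →
               IsUnionOfCycles σ I × (A.Admissible (std σ (∁ I)) u × A.Admissible (std σ I) v)
    restrict adm = cycles , (eu , proj₁ (to (linked-⊕ cycles) linked)) , (ev , proj₂ (to (linked-⊕ cycles) linked))
      where
      linked : Linked _≺⊕_ W (σ ⟨$⟩ʳ_)
      linked = to (AB.admissible-at _ w ew) adm
      cycles : IsUnionOfCycles σ I
      cycles = forward-closed⇒union-of-cycles σ I (linked⇒closed linked)

    glue : IsUnionOfCycles σ I × (A.Admissible (std σ (∁ I)) u × A.Admissible (std σ I) v) →
           AB.Admissible (σ ⟨$⟩ʳ_) w
    glue (cycles , admu , admv) =
      ew , from (linked-⊕ cycles) (to (A.admissible-at _ u eu) admu , to (A.admissible-at _ v ev) admv)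

module _ {n : ℕ} (σ : Permutation′ n) where
  open Admissibility _≺_ _≺?_

  term : Subset n → List Letter → List Letter → ℤ
  term I u v = SA (std σ (∁ I)) u *ℤ SA (std σ I) v

  admissible-pair? : (I : Subset n) (u v : List Letter) →
                     Dec (Admissible (std σ (∁ I)) u × Admissible (std σ I) v)
  admissible-pair? I u v = admissible? (std σ (∁ I)) u ×-dec admissible? (std σ I) v

  term-misfit : (I : Subset n) (u v : List Letter) →
                ¬ (length u ≡ count (∁ I) × length v ≡ count I) → term I u v ≡ 0ℤ
  term-misfit I u v misfit =
    trans (SGen-× _ _ u v) (χ-no (λ ((eu , _) , (ev , _)) → misfit (eu , ev)) (admissible-pair? I u v))

  interleave-value : (I : Subset n) (u v : List Letter) →
                     ⟦ SAB (σ ⟨$⟩ʳ_) ⟧ (interleave I u v) ≡ χ (isUnionOfCycles? σ I) *ℤ term I u v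
  interleave-value I u v with interleave I u v in w≡
  ... | just w = begin
    SAB (σ ⟨$⟩ʳ_) w                                 ≡⟨ AB.SGen-χ _ w ⟩
    χ (AB.admissible? _ w)                          ≡⟨ χ-cong admissible-⊕ (AB.admissible? _ w) (cycles? ×-dec pair?) ⟩
    χ (cycles? ×-dec pair?)                         ≡⟨ χ-× cycles? pair? ⟨
    χ cycles? *ℤ χ pair?                            ≡⟨ cong (χ cycles? *ℤ_) (SGen-× _ _ u v) ⟨
    χ cycles? *ℤ term I u v                         ∎
    where
    open ≡-Reasoning
    open Coproduct σ I w≡
    cycles? : Dec (IsUnionOfCycles σ I)
    cycles? = isUnionOfCycles? σ I
    pair? : Dec (Admissible (std σ (∁ I)) u × Admissible (std σ I) v)
    pair? = admissible-pair? I u v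
  ... | nothing = sym (trans (cong (χ (isUnionOfCycles? σ I) *ℤ_) (term-misfit I u v misfit))
                             (ℤP.*-zeroʳ (χ (isUnionOfCycles? σ I))))
    where
    misfit : ¬ (length u ≡ count (∁ I) × length v ≡ count I)
    misfit (eu , ev) with interleave-defined I u v eu ev
    ... | _ , w≡′ with () ← trans (sym w≡′) w≡

  coproduct-rule : (u v : List Letter) →
                   Δ𝐒 σ u v ≡ sum₂ (map (λ I → SA (std σ (∁ I)) ⊗ SA (std σ I)) (cycleUnions σ)) u v
  coproduct-rule u v with length u ℕ.+ length v ℕ.≟ n
  ... | yes fits = begin
    sumℤ (map (SAB (σ ⟨$⟩ʳ_)) (shuffles u v))
      ≡⟨ shuffles-as-interleavings u v n fits _ ⟩
    sumℤ (map (λ I → ⟦ SAB (σ ⟨$⟩ʳ_) ⟧ (interleave I u v)) (allSubsets n))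
      ≡⟨ sum-cong _ _ (allSubsets n) (λ I → interleave-value I u v) ⟩
    sumℤ (map (λ I → χ (isUnionOfCycles? σ I) *ℤ term I u v) (allSubsets n))
      ≡⟨ sum-filter (isUnionOfCycles? σ) (λ I → term I u v) (allSubsets n) ⟨
    sumℤ (map (λ I → term I u v) (cycleUnions σ))
      ≡⟨ sum-map-∘ (λ F → F u v) _ (cycleUnions σ) ⟨
    sum₂ (map (λ I → SA (std σ (∁ I)) ⊗ SA (std σ I)) (cycleUnions σ)) u v ∎
    where open ≡-Reasoning
  ... | no misfit = trans vanishˡ (sym vanishʳ)
    where
    vanishˡ : Δ𝐒 σ u v ≡ 0ℤ
    vanishˡ = sum-zero _ (shuffles u v) λ w w∈ →
      AB.SGen-length _ w (misfit ∘ trans (sym (shuffles-length u v w∈)))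
      where module AB = Admissibility _≺⊕_ _≺⊕?_
    vanishʳ : sum₂ (map (λ I → SA (std σ (∁ I)) ⊗ SA (std σ I)) (cycleUnions σ)) u v ≡ 0ℤ
    vanishʳ = trans (sum-map-∘ (λ F → F u v) _ (cycleUnions σ)) (sum-zero _ (cycleUnions σ) λ I _ →
      term-misfit I u v λ (eu , ev) → misfit (trans (cong₂ ℕ._+_ eu ev) (count-∁ I)))

theorem4p1 :
  ((m n : ℕ) (σ : Permutation′ m) (τ : Permutation′ n) (w : List Letter) →
    (𝐒 σ ⊛ 𝐒 τ) w ≡ 𝐒 (σ • τ) w)
  × ((w : List Letter) → 𝐒 ε₀ w ≡ oneS w)
  × ((L : List (Perm × ℤ)) →
      AllPairs (λ s t → code (proj₁ s) ≢ code (proj₁ t)) L →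
      ((w : List Letter) → evalComb L w ≡ 0ℤ) →
      All (λ t → proj₂ t ≡ 0ℤ) L)
  × ((n : ℕ) (σ : Permutation′ n) (u v : List Letter) →
      Δ𝐒 σ u v
        ≡ sum₂ (map (λ I → SA (std σ (∁ I)) ⊗ SA (std σ I)) (cycleUnions σ)) u v)
theorem4p1 =
    (λ m n σ τ → Concatenation.product-rule _≺_ _≺?_ σ τ)
  , unit-rule
  , linear-independence
  , (λ n σ → coproduct-rule σ)
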